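{- Let $G_1\subsetneq G_2\subsetneq\dots\subsetneq G_r$ be a sequence of distinct graphs on a common finite vertex set, each contained in the next (as edge sets). Let $1\le a<b<c<d\le r$. If $G_c\setminus G_a$ and $G_d\setminus G_b$ are both cliques, then $G_c\setminus G_b$ is also a clique.
   Context: Graphs are simple graphs on a common vertex set, identified with their edge sets; $G\subset H$ means the edge set of $G$ is contained in that of $H$, and $H\setminus G$ denotes the set of edges of $H$ not in $G$. A set of edges $E$ is called a clique if there is a set $S$ of at least two vertices such that $E$ is exactly the set of all pairs of distinct vertices of $S$. -}

module Defs where

open import Data.Nat using (ℕ; _≤_)
open import Data.Fin using (Fin)
open import Data.Fin.Subset using (Subset; _∈_; ∣_∣)
open import Data.Bool using (Bool; true; false)
open import Data.Product using (Σ; ∃; _×_)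
open import Relation.Binary.PropositionalEquality using (_≡_)
open import Relation.Nullary using (¬_)
open import Function.Bundles using (_⇔_)

record Graph (n : ℕ) : Set where
  field
    adj   : Fin n → Fin n → Bool
    sym   : ∀ u v → adj u v ≡ adj v u
    irrefl : ∀ u → adj u u ≡ false
open Graph public

-- An edge set: a symmetric predicate on ordered pairs of vertices
-- (the edge {u,v} is present iff E u v, equivalently E v u).
EdgeSet : ℕ → Set₁
EdgeSet n = Fin n → Fin n → Set

edges : ∀ {n} → Graph n → EdgeSet n
edges G u v = adj G u v ≡ true

_⊆ᴳ_ : ∀ {n} → Graph n → Graph n → Set
G ⊆ᴳ H = ∀ u v → edges G u v → edges H u v

_⊊ᴳ_ : ∀ {n} → Graph n → Graph n → Set
G ⊊ᴳ H = (G ⊆ᴳ H) × ∃ λ u → ∃ λ v → edges H u v × ¬ edges G u v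

_∖ᴳ_ : ∀ {n} → Graph n → Graph n → EdgeSet n
(H ∖ᴳ G) u v = edges H u v × ¬ edges G u v

IsClique : ∀ {n} → EdgeSet n → Set
IsClique {n} E = Σ (Subset n) λ S →
  (2 ≤ ∣ S ∣) × (∀ u v → E u v ⇔ (u ∈ S × v ∈ S × ¬ u ≡ v))

-- An edge set is a clique on S exactly when it is the edge set K(S) of the complete
-- graph on S, and K(S) ∩ K(T) = K(S ∩ T); so an intersection of two cliques is a
-- clique as soon as it has an edge. Since G a ⊆ G b and G c ⊆ G d, the edges of
-- G c ∖ G b are exactly those lying in both G c ∖ G a and G d ∖ G b, and G b ⊊ G c
-- provides an edge of G c ∖ G b.
module Submission where

open import Defs
open import Data.Nat using (ℕ; _≤_; s≤s; z≤n) renaming (_<_ to _<ℕ_)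
open import Data.Nat.Properties using (≤-trans; ≤-<-trans)
open import Data.Fin using (Fin; _<_)
open import Data.Fin.Subset using (Subset; _∩_; ∣_∣) renaming (_∈_ to _∈ₛ_)
open import Data.Fin.Subset.Properties using (x∈p∩q⁺; x∈p∩q⁻; x∈p∧x≢y⇒x∈p-y; x∈p⇒∣p-x∣<∣p∣)
open import Data.Product using (∃₂; _,_; proj₁; proj₂; _×_)
open import Relation.Binary.PropositionalEquality using (_≢_; ≢-sym)
open import Function.Bundles using (_⇔_; mk⇔; Equivalence)
open import Function.Properties.Equivalence using () renaming (sym to ⇔-sym; trans to ⇔-trans)

private
  variable
    n : ℕ

_∩ᴱ_ : EdgeSet n → EdgeSet n → EdgeSet n
(E ∩ᴱ F) u v = E u v × F u v

_≐_ : EdgeSet n → EdgeSet n → Set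
E ≐ F = ∀ u v → E u v ⇔ F u v

NonemptyEdgeSet : EdgeSet n → Set
NonemptyEdgeSet E = ∃₂ E

x∈p⇒0<∣p∣ : ∀ {p : Subset n} {x} → x ∈ₛ p → 0 <ℕ ∣ p ∣
x∈p⇒0<∣p∣ x∈p = ≤-<-trans z≤n (x∈p⇒∣p-x∣<∣p∣ x∈p)

x∈p∧y∈p∧x≢y⇒2≤∣p∣ : ∀ {p : Subset n} {x y} → x ∈ₛ p → y ∈ₛ p → x ≢ y → 2 ≤ ∣ p ∣
x∈p∧y∈p∧x≢y⇒2≤∣p∣ x∈p y∈p x≢y =
  ≤-trans (s≤s (x∈p⇒0<∣p∣ (x∈p∧x≢y⇒x∈p-y y∈p (≢-sym x≢y)))) (x∈p⇒∣p-x∣<∣p∣ x∈p)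

IsClique-resp-≐ : {E F : EdgeSet n} → E ≐ F → IsClique E → IsClique F
IsClique-resp-≐ E≐F (S , 2≤∣S∣ , E⇔K) = S , 2≤∣S∣ , λ u v → ⇔-trans (⇔-sym (E≐F u v)) (E⇔K u v)

IsClique-∩ : {E F : EdgeSet n} → IsClique E → IsClique F →
             NonemptyEdgeSet (E ∩ᴱ F) → IsClique (E ∩ᴱ F)
IsClique-∩ {E = E} {F} (S , _ , E⇔K) (T , _ , F⇔K) (x , y , EFxy) =
  S ∩ T , 2≤∣S∩T∣ , λ u v → mk⇔ (to u v) (from u v)
  where
  to : ∀ u v → (E ∩ᴱ F) u v → u ∈ₛ S ∩ T × v ∈ₛ S ∩ T × u ≢ v
  to u v (Euv , Fuv) =
    let (u∈S , v∈S , u≢v) = Equivalence.to (E⇔K u v) Euv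
        (u∈T , v∈T , _)   = Equivalence.to (F⇔K u v) Fuv
    in x∈p∩q⁺ (u∈S , u∈T) , x∈p∩q⁺ (v∈S , v∈T) , u≢v

  from : ∀ u v → u ∈ₛ S ∩ T × v ∈ₛ S ∩ T × u ≢ v → (E ∩ᴱ F) u v
  from u v (u∈S∩T , v∈S∩T , u≢v) =
    let (u∈S , u∈T) = x∈p∩q⁻ S T u∈S∩T
        (v∈S , v∈T) = x∈p∩q⁻ S T v∈S∩T
    in Equivalence.from (E⇔K u v) (u∈S , v∈S , u≢v) ,
       Equivalence.from (F⇔K u v) (u∈T , v∈T , u≢v)

  2≤∣S∩T∣ : 2 ≤ ∣ S ∩ T ∣
  2≤∣S∩T∣ = let (x∈S∩T , y∈S∩T , x≢y) = to x y EFxy in x∈p∧y∈p∧x≢y⇒2≤∣p∣ x∈S∩T y∈S∩T x≢y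

∖ᴳ-∩ᴱ-∖ᴳ-≐ : {A B C D : Graph n} → A ⊆ᴳ B → C ⊆ᴳ D → ((C ∖ᴳ A) ∩ᴱ (D ∖ᴳ B)) ≐ (C ∖ᴳ B)
∖ᴳ-∩ᴱ-∖ᴳ-≐ A⊆B C⊆D u v = mk⇔
  (λ ((Cuv , _) , (_ , ¬Buv)) → Cuv , ¬Buv)
  (λ (Cuv , ¬Buv) → (Cuv , λ Auv → ¬Buv (A⊆B u v Auv)) , (C⊆D u v Cuv , ¬Buv))

lemma1 : (n r : ℕ) (G : Fin r → Graph n)
         → (∀ i j → i < j → G i ⊊ᴳ G j)
         → (a b c d : Fin r) → a < b → b < c → c < d
         → IsClique (G c ∖ᴳ G a) → IsClique (G d ∖ᴳ G b)
         → IsClique (G c ∖ᴳ G b)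
lemma1 n r G G-⊊ a b c d a<b b<c c<d cliqueᶜᵃ cliqueᵈᵇ =
  IsClique-resp-≐ ∩≐∖ (IsClique-∩ cliqueᶜᵃ cliqueᵈᵇ edge)
  where
  ∩≐∖ : ((G c ∖ᴳ G a) ∩ᴱ (G d ∖ᴳ G b)) ≐ (G c ∖ᴳ G b)
  ∩≐∖ = ∖ᴳ-∩ᴱ-∖ᴳ-≐ {A = G a} {G b} {G c} {G d} (proj₁ (G-⊊ a b a<b)) (proj₁ (G-⊊ c d c<d))

  edge : NonemptyEdgeSet ((G c ∖ᴳ G a) ∩ᴱ (G d ∖ᴳ G b))
  edge = let (u , v , uv∈Gc∖Gb) = proj₂ (G-⊊ b c b<c)
         in u , v , Equivalence.from (∩≐∖ u v) uv∈Gc∖Gb
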